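{- Let $N = p^k m^2$ be an odd perfect number, where $p$ is a prime with $p \equiv k \equiv 1 \pmod 4$, $k$ a positive integer, $m$ a positive integer and $\gcd(p,m)=1$. Then $$\frac{2\sqrt{10}}{5} < I(p^k)\,I(m) = \frac{\sigma(p^k)}{m}\cdot\frac{\sigma(m)}{p^k} < 2.$$
   Context: $\sigma(n)$ denotes the sum of the positive divisors of $n$ and $I(n)=\sigma(n)/n$ is the abundancy index. An odd perfect number is an odd positive integer $N$ with $\sigma(N)=2N$. -}

module Defs where

open import Data.Nat using (ℕ; zero; suc)
open import Data.Nat.Divisibility using (_∣?_)
open import Data.List using (filter; applyUpTo)
open import Data.Nat.ListAction using (sum)
open import Data.Integer using (+_)
open import Data.Rational using (ℚ; 0ℚ; _/_)

σ : ℕ → ℕ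
σ n = sum (filter (_∣? n) (applyUpTo suc n))

-- a / b as a rational number (b = 0 is never used; convention: 0)
_÷ℕ_ : ℕ → ℕ → ℚ
a ÷ℕ zero    = 0ℚ
a ÷ℕ (suc b) = (+ a) / (suc b)

I : ℕ → ℚ
I n = σ n ÷ℕ n

{-# OPTIONS --safe #-}
-- Write P = p ^ k and X = σ(P) σ(m) / (P m).  As σ is submultiplicative and σ(P) ≥ P,
-- (σ(P) σ(m))² ≥ P σ(P) σ(m)² ≥ P σ(P m²) = 2 (P m)², so X² ≥ 2 > 8/5.  For the upper bound,
-- σ(P) σ(m) = σ(P m) by coprimality, and 1 together with the m d (d ∣ P m) are distinct divisors
-- of P m², whence m σ(P m) < σ(P m²) = m · 2 P m, i.e. X < 2.  This needs m > 1, which holds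
-- because a prime power is never perfect: σ(p ^ k) ≡ 1 (mod p).
module Submission where

open import Defs
open import Data.Nat using (ℕ; _*_; _^_; _%_; _<_)
open import Data.Nat.Primality using (Prime)
open import Data.Nat.Coprimality using (Coprime)
open import Data.Product using (_×_)
open import Data.Integer using (+_)
open import Relation.Binary.PropositionalEquality using (_≡_)
open import Data.Rational using (ℚ; 0ℚ; _/_) renaming (_<_ to _<ℚ_; _*_ to _*ℚ_)

open import Data.Nat using (zero; suc; pred; _+_; _≤_; NonZero; z≤n; s≤s; z<s; s<s; ≢-nonZero; >-nonZero; nonTrivial⇒n>1)
open import Data.Nat.Properties
open import Data.Nat.Divisibility
open import Data.Nat.DivMod using (m*[n/m]≡n) renaming (_/_ to _div_)
open import Data.Nat.GCD using (gcd; gcd[m,n]∣m; gcd[m,n]∣n; gcd[m,n]≢0)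
open import Data.Nat.Coprimality using (coprime-divisor; coprime-/gcd)
open import Data.Nat.Primality using (prime⇒irreducible; prime⇒nonTrivial; prime⇒nonZero)
open import Data.Nat.ListAction using (sum)
open import Data.Nat.ListAction.Properties using (sum-++)
open import Data.Nat.Tactic.RingSolver using (solve-∀)
open import Data.Integer as ℤ using ()
open import Data.Integer.Properties using (+◃n≡+n; +◃-mono-<)
open import Data.Rational using (toℚᵘ; fromℚᵘ)
open import Data.Rational.Properties using (toℚᵘ-injective; toℚᵘ-fromℚᵘ; toℚᵘ-homo-*; toℚᵘ-cancel-<)
open import Data.Rational.Unnormalised as ℚᵘ using (ℚᵘ; mkℚᵘ; *≡*; *<*)
import Data.Rational.Unnormalised.Properties as ℚᵘ
open import Data.List using (List; []; _∷_; _++_; map; filter; applyUpTo; cartesianProductWith)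
open import Data.List.Properties using (filter-accept)
open import Data.List.Membership.Propositional using (_∈_)
open import Data.List.Membership.Propositional.Properties
open import Data.List.Relation.Binary.Subset.Propositional using (_⊆_)
open import Data.List.Relation.Unary.All as All using (All; []; _∷_)
open import Data.List.Relation.Unary.Any using (here; there)
open import Data.List.Relation.Unary.Unique.Propositional using (Unique; []; _∷_)
import Data.List.Relation.Unary.Unique.Propositional.Properties as Unique
open import Data.Product using (_,_; proj₁; proj₂; ∃₂)
open import Data.Sum using (inj₁; inj₂)
open import Data.Empty using (⊥-elim)
open import Function using (_∘_; _$_; case_of_)
open import Relation.Nullary using (¬_; yes; no)
open import Relation.Binary.PropositionalEquality using (_≢_; refl; sym; trans; cong; cong₂; subst; subst₂; module ≡-Reasoning)

sum-mono-⊆ : {xs ys : List ℕ} → Unique xs → xs ⊆ ys → sum xs ≤ sum ys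
sum-mono-⊆ {[]} _ _ = z≤n
sum-mono-⊆ {x ∷ xs} (x∉xs ∷ xs-unique) xs⊆ys with ∈-∃++ (xs⊆ys (here refl))
... | as , bs , refl = begin
  x + sum xs            ≤⟨ +-monoʳ-≤ x (sum-mono-⊆ xs-unique xs⊆as++bs) ⟩
  x + sum (as ++ bs)    ≡⟨ cong (_+_ x) (sum-++ as bs) ⟩
  x + (sum as + sum bs) ≡⟨ x∙yz≈y∙xz x (sum as) (sum bs) ⟩
  sum as + (x + sum bs) ≡⟨ sum-++ as (x ∷ bs) ⟨
  sum (as ++ x ∷ bs)    ∎
  where
  open ≤-Reasoning
  open import Algebra.Properties.CommutativeSemigroup +-commutativeSemigroup using (x∙yz≈y∙xz)
  xs⊆as++bs : xs ⊆ as ++ bs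
  xs⊆as++bs y∈xs with ∈-++⁻ as (xs⊆ys (there y∈xs))
  ... | inj₁ y∈as = ∈-++⁺ˡ y∈as
  ... | inj₂ (here refl) = ⊥-elim (All.lookup x∉xs y∈xs refl)
  ... | inj₂ (there y∈bs) = ∈-++⁺ʳ as y∈bs

sum-map-* : ∀ x ys → sum (map (x *_) ys) ≡ x * sum ys
sum-map-* x [] = sym (*-zeroʳ x)
sum-map-* x (y ∷ ys) = trans (cong (_+_ (x * y)) (sum-map-* x ys)) (sym (*-distribˡ-+ x y (sum ys)))

sum-cartesianProductWith-* : ∀ xs ys → sum (cartesianProductWith _*_ xs ys) ≡ sum xs * sum ys
sum-cartesianProductWith-* [] ys = refl
sum-cartesianProductWith-* (x ∷ xs) ys = begin
  sum (map (x *_) ys ++ cartesianProductWith _*_ xs ys)        ≡⟨ sum-++ (map (x *_) ys) _ ⟩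
  sum (map (x *_) ys) + sum (cartesianProductWith _*_ xs ys)   ≡⟨ cong₂ _+_ (sum-map-* x ys) (sum-cartesianProductWith-* xs ys) ⟩
  x * sum ys + sum xs * sum ys                                  ≡⟨ *-distribʳ-+ (sum ys) x (sum xs) ⟨
  (x + sum xs) * sum ys                                         ∎
  where open ≡-Reasoning

∣-sum : ∀ {d xs} → All (d ∣_) xs → d ∣ sum xs
∣-sum [] = _ ∣0
∣-sum (d∣x ∷ d∣xs) = ∣m∣n⇒∣m+n d∣x (∣-sum d∣xs)

cartesianProductWith-*-unique : ∀ {xs ys} → Unique xs → Unique ys → All (0 <_) xs →
  (∀ {x x′ y y′} → x ∈ xs → x′ ∈ xs → y ∈ ys → y′ ∈ ys → x * y ≡ x′ * y′ → x ≡ x′) →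
  Unique (cartesianProductWith _*_ xs ys)
cartesianProductWith-*-unique {[]} _ _ _ _ = []
cartesianProductWith-*-unique {x ∷ xs} {ys} (x∉xs ∷ xs-unique) ys-unique (x>0 ∷ xs>0) injective =
  Unique.++⁺ (Unique.map⁺ (*-cancelˡ-≡ _ _ x {{>-nonZero x>0}}) ys-unique)
             (cartesianProductWith-*-unique xs-unique ys-unique xs>0 (λ x∈ x′∈ → injective (there x∈) (there x′∈)))
             disjoint
  where
  disjoint : ∀ {v} → ¬ (v ∈ map (x *_) ys × v ∈ cartesianProductWith _*_ xs ys)
  disjoint (v∈xys , v∈rest) with ∈-map⁻ (x *_) v∈xys | ∈-cartesianProductWith⁻ _*_ xs ys v∈rest
  ... | y , y∈ys , refl | x′ , y′ , x′∈xs , y′∈ys , eq =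
    All.lookup x∉xs x′∈xs (injective (here refl) (there x′∈xs) y∈ys y′∈ys eq)

divisors : ℕ → List ℕ
divisors n = filter (_∣? n) (applyUpTo suc n)

∈-divisors⁻ : ∀ n {d} → d ∈ divisors n → d ∣ n × 0 < d
∈-divisors⁻ n d∈ with ∈-filter⁻ (_∣? n) {xs = applyUpTo suc n} d∈
... | d∈range , d∣n with ∈-applyUpTo⁻ suc d∈range
... | _ , _ , refl = d∣n , z<s

∈-divisors⁺ : ∀ {n d} → 0 < n → d ∣ n → d ∈ divisors n
∈-divisors⁺ {suc n} {zero} _ 0∣n = ⊥-elim (1+n≢0 (0∣⇒≡0 0∣n))
∈-divisors⁺ {suc n} {suc d} _ d∣n = ∈-filter⁺ (_∣? suc n) (∈-applyUpTo⁺ suc (∣⇒≤ d∣n)) d∣n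

divisors-unique : ∀ n → Unique (divisors n)
divisors-unique n = Unique.filter⁺ (_∣? n) (Unique.applyUpTo⁺₁ suc n (λ i<j _ → <⇒≢ i<j ∘ suc-injective))

divisors-pos : ∀ n → All (0 <_) (divisors n)
divisors-pos n = All.tabulate (proj₂ ∘ ∈-divisors⁻ n)

∣*⇒∣×∣ : ∀ {a b d} → 0 < a → d ∣ a * b → ∃₂ λ d₁ d₂ → d₁ ∣ a × d₂ ∣ b × d ≡ d₁ * d₂
∣*⇒∣×∣ {a} {b} {d} a>0 d∣ab = g , d div g , gcd[m,n]∣n d a , d/g∣b , sym (m*[n/m]≡n (gcd[m,n]∣m d a))
  where
  g : ℕ
  g = gcd d a
  instance
    g≢0 : NonZero g
    g≢0 = ≢-nonZero (gcd[m,n]≢0 d a (inj₂ (m<n⇒n≢0 a>0)))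
  g*[a/g*b]≡a*b : g * ((a div g) * b) ≡ a * b
  g*[a/g*b]≡a*b = trans (sym (*-assoc g (a div g) b)) (cong (_* b) (m*[n/m]≡n (gcd[m,n]∣n d a)))
  d/g∣a/g*b : (d div g) ∣ (a div g) * b
  d/g∣a/g*b = *-cancelˡ-∣ g (subst₂ _∣_ (sym (m*[n/m]≡n (gcd[m,n]∣m d a))) (sym g*[a/g*b]≡a*b) d∣ab)
  d/g∣b : (d div g) ∣ b
  d/g∣b = coprime-divisor (coprime-/gcd d a) d/g∣a/g*b

n≤σ[n] : ∀ {n} → 0 < n → n ≤ σ n
n≤σ[n] {n} n>0 = subst (_≤ σ n) (+-identityʳ n)
  (sum-mono-⊆ ([] ∷ []) λ { (here refl) → ∈-divisors⁺ n>0 ∣-refl })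

σ-pos : ∀ {n} → 0 < n → 0 < σ n
σ-pos n>0 = <-≤-trans n>0 (n≤σ[n] n>0)

σ-submultiplicative : ∀ {a b} → 0 < a → 0 < b → σ (a * b) ≤ σ a * σ b
σ-submultiplicative {a} {b} a>0 b>0 =
  subst (σ (a * b) ≤_) (sum-cartesianProductWith-* (divisors a) (divisors b))
        (sum-mono-⊆ (divisors-unique (a * b)) ⊆products)
  where
  ⊆products : divisors (a * b) ⊆ cartesianProductWith _*_ (divisors a) (divisors b)
  ⊆products d∈ with ∣*⇒∣×∣ a>0 (proj₁ (∈-divisors⁻ (a * b) d∈))
  ... | d₁ , d₂ , d₁∣a , d₂∣b , refl =
    ∈-cartesianProductWith⁺ _*_ (∈-divisors⁺ a>0 d₁∣a) (∈-divisors⁺ b>0 d₂∣b)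

σ-supermultiplicative : ∀ {a b} → 0 < a → 0 < b → Coprime a b → σ a * σ b ≤ σ (a * b)
σ-supermultiplicative {a} {b} a>0 b>0 a⊥b =
  subst (_≤ σ (a * b)) (sum-cartesianProductWith-* (divisors a) (divisors b))
        (sum-mono-⊆ (cartesianProductWith-*-unique (divisors-unique a) (divisors-unique b)
                                                     (divisors-pos a) injective)
                    products⊆)
  where
  products⊆ : cartesianProductWith _*_ (divisors a) (divisors b) ⊆ divisors (a * b)
  products⊆ v∈ with ∈-cartesianProductWith⁻ _*_ (divisors a) (divisors b) v∈
  ... | x , y , x∈ , y∈ , refl =
    ∈-divisors⁺ (*-mono-< a>0 b>0) (*-pres-∣ (proj₁ (∈-divisors⁻ a x∈)) (proj₁ (∈-divisors⁻ b y∈)))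
  ∣-factor : ∀ {x x′ y y′} → x ∣ a → y′ ∣ b → x * y ≡ x′ * y′ → x ∣ x′
  ∣-factor {x} {x′} {y} {y′} x∣a y′∣b eq = coprime-divisor x⊥y′
    (subst (x ∣_) (trans eq (*-comm x′ y′)) (m∣m*n y))
    where
    x⊥y′ : Coprime x y′
    x⊥y′ (i∣x , i∣y′) = a⊥b (∣-trans i∣x x∣a , ∣-trans i∣y′ y′∣b)
  injective : ∀ {x x′ y y′} → x ∈ divisors a → x′ ∈ divisors a → y ∈ divisors b → y′ ∈ divisors b →
              x * y ≡ x′ * y′ → x ≡ x′
  injective x∈ x′∈ y∈ y′∈ eq = ∣-antisym
    (∣-factor (proj₁ (∈-divisors⁻ a x∈)) (proj₁ (∈-divisors⁻ b y′∈)) eq)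
    (∣-factor (proj₁ (∈-divisors⁻ a x′∈)) (proj₁ (∈-divisors⁻ b y∈)) (sym eq))

σ-multiplicative : ∀ {a b} → 0 < a → 0 < b → Coprime a b → σ (a * b) ≡ σ a * σ b
σ-multiplicative a>0 b>0 a⊥b =
  ≤-antisym (σ-submultiplicative a>0 b>0) (σ-supermultiplicative a>0 b>0 a⊥b)

m*σ[n]<σ[n*m] : ∀ {n m} → 0 < n → 1 < m → m * σ n < σ (n * m)
m*σ[n]<σ[n*m] {n} {m} n>0 m>1 = subst (_≤ σ (n * m)) (cong suc (sum-map-* m (divisors n))) $
  sum-mono-⊆ (1∉multiples ∷ Unique.map⁺ (*-cancelˡ-≡ _ _ m) (divisors-unique n)) ⊆divisors
  where
  m>0 : 0 < m
  m>0 = <-trans z<s m>1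
  instance
    m≢0 : NonZero m
    m≢0 = >-nonZero m>0
  multiples : List ℕ
  multiples = map (m *_) (divisors n)
  1∉multiples : All (1 ≢_) multiples
  1∉multiples = All.tabulate λ v∈ 1≡v → case ∈-map⁻ (m *_) v∈ of λ where
    (d , _ , refl) → >⇒≢ m>1 (∣1⇒≡1 (subst (m ∣_) (sym 1≡v) (m∣m*n d)))
  ⊆divisors : 1 ∷ multiples ⊆ divisors (n * m)
  ⊆divisors (here refl) = ∈-divisors⁺ (*-mono-< n>0 m>0) (1∣ _)
  ⊆divisors (there v∈) with ∈-map⁻ (m *_) v∈
  ... | d , d∈ , refl = ∈-divisors⁺ (*-mono-< n>0 m>0)
    (subst (m * d ∣_) (*-comm m n) (*-pres-∣ (∣-refl {m}) (proj₁ (∈-divisors⁻ n d∈))))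

Perfect : ℕ → Set
Perfect n = σ n ≡ 2 * n

-- σ n ≡ 1 (mod q) since every divisor but 1 is a multiple of q, while 2 n ≡ 0 (mod q).
common-factor⇒¬perfect : ∀ {q n} → 1 < q → 0 < n → q ∣ n → (∀ {d} → d ∣ n → 1 < d → q ∣ d) →
                         ¬ Perfect n
common-factor⇒¬perfect {q} {suc n} q>1 _ q∣n q∣divisors σ≡2*n = >⇒≢ q>1 (∣1⇒≡1 q∣1)
  where
  others : List ℕ
  others = filter (_∣? suc n) (applyUpTo (suc ∘ suc) n)
  σ≡1+others : σ (suc n) ≡ 1 + sum others
  σ≡1+others = cong sum (filter-accept (_∣? suc n) (1∣ suc n))
  q∣other : ∀ {d} → d ∈ others → q ∣ d
  q∣other d∈ with ∈-filter⁻ (_∣? suc n) {xs = applyUpTo (suc ∘ suc) n} d∈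
  ... | d∈range , d∣n with ∈-applyUpTo⁻ (suc ∘ suc) d∈range
  ... | _ , _ , refl = q∣divisors d∣n (s<s z<s)
  q∣others+1 : q ∣ sum others + 1
  q∣others+1 = subst (q ∣_) (trans (sym σ≡2*n) (trans σ≡1+others (+-comm 1 _))) (∣n⇒∣m*n 2 q∣n)
  q∣1 : q ∣ 1
  q∣1 = ∣m+n∣m⇒∣n q∣others+1 (∣-sum (All.tabulate q∣other))

prime∤⇒coprime : ∀ {p d} → Prime p → ¬ p ∣ d → Coprime d p
prime∤⇒coprime p-prime p∤d (i∣d , i∣p) with prime⇒irreducible p-prime i∣p
... | inj₁ i≡1 = i≡1
... | inj₂ refl = ⊥-elim (p∤d i∣d)

prime∣divisor-of-power : ∀ {p d} k → Prime p → d ∣ p ^ k → 1 < d → p ∣ d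
prime∣divisor-of-power zero _ d∣1 d>1 = ⊥-elim (>⇒≢ d>1 (∣1⇒≡1 d∣1))
prime∣divisor-of-power {p} {d} (suc k) p-prime d∣p^k+1 d>1 with p ∣? d
... | yes p∣d = p∣d
... | no p∤d = prime∣divisor-of-power k p-prime
  (coprime-divisor (prime∤⇒coprime p-prime p∤d) d∣p^k+1) d>1

prime-power-not-perfect : ∀ {p k} → Prime p → 0 < k → ¬ Perfect (p ^ k)
prime-power-not-perfect {p} {suc k} p-prime _ = common-factor⇒¬perfect
  (nonTrivial⇒n>1 p {{prime⇒nonTrivial p-prime}}) (m^n>0 p {{prime⇒nonZero p-prime}} (suc k))
  (m∣m*n (p ^ k)) (prime∣divisor-of-power (suc k) p-prime)

coprime-^ˡ : ∀ {p m} k → Coprime p m → Coprime (p ^ k) m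
coprime-^ˡ zero _ (i∣1 , _) = ∣1⇒≡1 i∣1
coprime-^ˡ (suc k) p⊥m {i} (i∣p^k+1 , i∣m) = coprime-^ˡ k p⊥m (coprime-divisor i⊥p i∣p^k+1 , i∣m)
  where
  i⊥p : Coprime i _
  i⊥p (j∣i , j∣p) = p⊥m (j∣p , ∣-trans j∣i i∣m)

perfect⇒2[nm]²≤[σnσm]² : ∀ {n m} → 0 < n → 0 < m → Perfect (n * (m * m)) →
                        2 * (n * m) * (n * m) ≤ (σ n * σ m) * (σ n * σ m)
perfect⇒2[nm]²≤[σnσm]² {n} {m} n>0 m>0 perfect = begin
  2 * (n * m) * (n * m)      ≡⟨ regroupˡ n m ⟩
  n * (2 * (n * (m * m)))    ≡⟨ cong (n *_) perfect ⟨
  n * σ (n * (m * m))        ≤⟨ *-mono-≤ (n≤σ[n] n>0) (σ-submultiplicative n>0 (*-mono-< m>0 m>0)) ⟩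
  σ n * (σ n * σ (m * m))    ≤⟨ *-monoʳ-≤ (σ n) (*-monoʳ-≤ (σ n) (σ-submultiplicative m>0 m>0)) ⟩
  σ n * (σ n * (σ m * σ m))  ≡⟨ regroupʳ (σ n) (σ m) ⟩
  (σ n * σ m) * (σ n * σ m)  ∎
  where
  open ≤-Reasoning
  regroupˡ : ∀ x y → 2 * (x * y) * (x * y) ≡ x * (2 * (x * (y * y)))
  regroupˡ = solve-∀
  regroupʳ : ∀ x y → x * (x * (y * y)) ≡ (x * y) * (x * y)
  regroupʳ = solve-∀

perfect⇒σnσm<2nm : ∀ {n m} → 0 < n → 1 < m → Coprime n m → Perfect (n * (m * m)) →
                   σ n * σ m < 2 * (n * m)
perfect⇒σnσm<2nm {n} {m} n>0 m>1 n⊥m perfect = *-cancelˡ-< m _ _ (begin-strict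
  m * (σ n * σ m)        ≡⟨ cong (m *_) (σ-multiplicative n>0 m>0 n⊥m) ⟨
  m * σ (n * m)          <⟨ m*σ[n]<σ[n*m] (*-mono-< n>0 m>0) m>1 ⟩
  σ (n * m * m)          ≡⟨ cong σ (*-assoc n m m) ⟩
  σ (n * (m * m))        ≡⟨ perfect ⟩
  2 * (n * (m * m))      ≡⟨ regroup n m ⟩
  m * (2 * (n * m))      ∎)
  where
  open ≤-Reasoning
  m>0 : 0 < m
  m>0 = <-trans z<s m>1
  regroup : ∀ x y → 2 * (x * (y * y)) ≡ y * (2 * (x * y))
  regroup = solve-∀

÷ℕ-* : ∀ a b {c d} → 0 < c → 0 < d → (a ÷ℕ c) *ℚ (b ÷ℕ d) ≡ (a * b) ÷ℕ (c * d)
÷ℕ-* a b {suc c} {suc d} _ _ = toℚᵘ-injective (begin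
  toℚᵘ (fromℚᵘ x *ℚ fromℚᵘ y)            ≈⟨ toℚᵘ-homo-* (fromℚᵘ x) (fromℚᵘ y) ⟩
  toℚᵘ (fromℚᵘ x) ℚᵘ.* toℚᵘ (fromℚᵘ y)   ≈⟨ ℚᵘ.*-cong (toℚᵘ-fromℚᵘ x) (toℚᵘ-fromℚᵘ y) ⟩
  x ℚᵘ.* y                               ≈⟨ *≡* (cong (ℤ._* + (suc c * suc d)) (+◃n≡+n (a * b))) ⟩
  xy                                     ≈⟨ toℚᵘ-fromℚᵘ xy ⟨
  toℚᵘ (fromℚᵘ xy)                       ∎)
  where
  open ℚᵘ.≃-Reasoning
  x y xy : ℚᵘ
  x = mkℚᵘ (+ a) c
  y = mkℚᵘ (+ b) d
  xy = mkℚᵘ (+ (a * b)) (pred (suc c * suc d))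

÷ℕ-<-÷ℕ : ∀ a c {b d} → 0 < b → 0 < d → a * d < c * b → a ÷ℕ b <ℚ c ÷ℕ d
÷ℕ-<-÷ℕ a c {suc b} {suc d} _ _ ad<cb = toℚᵘ-cancel-<
  (ℚᵘ.<-respˡ-≃ (ℚᵘ.≃-sym (toℚᵘ-fromℚᵘ x)) (ℚᵘ.<-respʳ-≃ (ℚᵘ.≃-sym (toℚᵘ-fromℚᵘ y))
    (*<* (+◃-mono-< ad<cb))))
  where
  x y : ℚᵘ
  x = mkℚᵘ (+ a) b
  y = mkℚᵘ (+ c) d

÷ℕ-pos : ∀ {a b} → 0 < a → 0 < b → 0ℚ <ℚ a ÷ℕ b
÷ℕ-pos {a} {b} a>0 b>0 = ÷ℕ-<-÷ℕ 0 a z<s b>0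
  (subst₂ _<_ (sym (*-zeroˡ b)) (sym (*-identityʳ a)) a>0)

÷ℕ<n : ∀ {a b} n → 0 < b → a < n * b → a ÷ℕ b <ℚ n ÷ℕ 1
÷ℕ<n {a} n b>0 a<nb = ÷ℕ-<-÷ℕ a n b>0 z<s (subst (_< n * _) (sym (*-identityʳ a)) a<nb)

8/5<[a÷ℕb]² : ∀ {a b} → 0 < b → 2 * b * b ≤ a * a → 8 ÷ℕ 5 <ℚ (a ÷ℕ b) *ℚ (a ÷ℕ b)
8/5<[a÷ℕb]² {a} {b} b>0 2b²≤a² = subst (8 ÷ℕ 5 <ℚ_) (sym (÷ℕ-* a a b>0 b>0))
  (÷ℕ-<-÷ℕ 8 (a * a) z<s (*-mono-< b>0 b>0) 8b²<5a²)
  where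
  open ≤-Reasoning
  regroup : ∀ x → 10 * (x * x) ≡ 2 * x * x * 5
  regroup = solve-∀
  8b²<5a² : 8 * (b * b) < a * a * 5
  8b²<5a² = begin-strict
    8 * (b * b)        <⟨ *-monoˡ-< (b * b) {{>-nonZero (*-mono-< b>0 b>0)}} (s≤s (m≤m+n 8 1)) ⟩
    10 * (b * b)       ≡⟨ regroup b ⟩
    2 * b * b * 5      ≤⟨ *-monoˡ-≤ 5 2b²≤a² ⟩
    a * a * 5          ∎

lemma4p2p8 : (N p k m : ℕ) → N % 2 ≡ 1 → σ N ≡ 2 * N → N ≡ p ^ k * (m * m)
             → Prime p → p % 4 ≡ 1 → k % 4 ≡ 1 → 0 < k → 0 < m → Coprime p m
             → let X = I (p ^ k) *ℚ I m in
               (0ℚ <ℚ X × (+ 8) / 5 <ℚ X *ℚ X)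
               × X ≡ (σ (p ^ k) ÷ℕ m) *ℚ (σ m ÷ℕ (p ^ k))
               × X <ℚ (+ 2) / 1
lemma4p2p8 N p k m _ N-perfect refl p-prime _ _ k>0 m>0 p⊥m
  rewrite ÷ℕ-* (σ (p ^ k)) (σ m) (m^n>0 p {{prime⇒nonZero p-prime}} k) m>0
  = ( ÷ℕ-pos (*-mono-< (σ-pos P>0) (σ-pos m>0)) Pm>0
    , 8/5<[a÷ℕb]² Pm>0 (perfect⇒2[nm]²≤[σnσm]² P>0 m>0 N-perfect) )
  , trans (cong ((σ P * σ m) ÷ℕ_) (*-comm P m)) (sym (÷ℕ-* (σ P) (σ m) m>0 P>0))
  , ÷ℕ<n 2 Pm>0 (perfect⇒σnσm<2nm P>0 m>1 (coprime-^ˡ k p⊥m) N-perfect)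
  where
  P : ℕ
  P = p ^ k
  P>0 : 0 < P
  P>0 = m^n>0 p {{prime⇒nonZero p-prime}} k
  Pm>0 : 0 < P * m
  Pm>0 = *-mono-< P>0 m>0
  m≢1 : m ≢ 1
  m≢1 refl = prime-power-not-perfect p-prime k>0 (subst Perfect (*-identityʳ P) N-perfect)
  m>1 : 1 < m
  m>1 = ≤∧≢⇒< m>0 (m≢1 ∘ sym)
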